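{- Let $n\ge1$ and let $\pi$ be a permutation of $\mathbb{Z}_n=\{0,1,\dots,n-1\}$ consisting of a single $n$-cycle. Let $p=n+1$, $\varphi(i)=ip\bmod n^2$ for $i\in\mathbb{Z}_{n^2}$, and for $t,g\in\mathbb{Z}_n$ let $f(t,g)=\varphi(gn+((t-g)\bmod n))$ (the unique position of $\mathbb{Z}_{n^2}$ lying in $\{tn,\dots,tn+n-1\}$ and in $\{\varphi(gn),\dots,\varphi(gn+n-1)\}$). Define words $u'=u'_0\cdots u'_{n^2-1}$ and $v'=v'_0\cdots v'_{n^2-1}$ over $\mathbb{Z}_n$ as follows. Call the positions $f(\pi^k(0),k)$, $k\in\mathbb{Z}_n$, distinguished, and set $u'_{f(\pi^k(0),k)}=\pi^k(0)$ and $v'_{f(\pi^k(0),k)}=\pi^{k+1}(0)$. Writing $a_i=u'_{\varphi(i)}$ and $b_i=v'_{\varphi(i)}$, for $i=1,2,\dots,n^2-1$ in increasing order, if $\varphi(i)$ is not distinguished set $a_i=b_{i-1}$ and $b_i=b_{i-1}$. Then $R_p(u')$ and $R_p(v')$ are cyclically equivalent with offset $1$, i.e. $b_i=a_{(i+1)\bmod n^2}$ for all $i\in\mathbb{Z}_{n^2}$.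
   Context: For $w=w_0\cdots w_{N-1}$ and $\gcd(p,N)=1$, the reading with step size $p$ is $R_p(w)=w_0w_pw_{2p}\cdots w_{(N-1)p}$ (indices modulo $N$); thus $R_p(u')=a_0a_1\cdots a_{n^2-1}$ and $R_p(v')=b_0b_1\cdots b_{n^2-1}$. Note $\varphi(0)=0=f(0,0)$ is distinguished, so $a_0,b_0$ are defined by the distinguished rule. Words $x,y$ of length $N$ are cyclically equivalent with offset $r$ if $y_j=x_{(j+r)\bmod N}$ for all $j$. -}

module Defs where

open import Data.Nat using (ℕ; zero; suc; _+_; _*_; _∸_; _%_; _/_)
open import Data.Nat.Properties using (_≟_)
open import Data.Fin using (Fin; toℕ) renaming (zero to fzero)
open import Data.Fin.Permutation using (Permutation′; _⟨$⟩ʳ_)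
open import Data.Fin.Properties using (any?)
open import Data.Product using (_×_; _,_; ∃; proj₁; proj₂)
open import Function using (_∘_)
open import Relation.Nullary using (yes; no)
open import Relation.Binary.PropositionalEquality using (_≡_)

module Construction (m : ℕ) (π : Permutation′ (suc m)) where

  n : ℕ
  n = suc m

  N : ℕ
  N = n * n

  p : ℕ
  p = suc n

  φ : ℕ → ℕ
  φ i = (i * p) % N

  subMod : ℕ → ℕ → ℕ
  subMod t g = (t + n ∸ g) % n

  f : ℕ → ℕ → ℕ
  f t g = φ (g * n + subMod t g)

  πpow : ℕ → Fin n → Fin n
  πpow zero    x = x
  πpow (suc k) x = π ⟨$⟩ʳ (πpow k x)

  orb : ℕ → Fin n
  orb k = πpow k fzero

  distPos : Fin n → ℕ
  distPos k = f (toℕ (orb (toℕ k))) (toℕ k)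

  distLetters : Fin n → Fin n × Fin n
  distLetters k = orb (toℕ k) , orb (suc (toℕ k))

  -- (a_i , b_i) = (u'_{φ(i)} , v'_{φ(i)}), defined for i = 0,1,2,... in increasing order.
  -- If φ(i) is distinguished, i.e. φ(i) = f(π^k(0),k) for some k ∈ ℤ_n, use the
  -- distinguished rule; otherwise a_i = b_i = b_{i-1}.
  -- (φ(0) = 0 = f(0,0) is distinguished, so the fallback at i = 0 is never used.)
  ab : ℕ → Fin n × Fin n
  ab i with any? (λ k → φ i ≟ distPos k)
  ... | yes (k , _) = distLetters k
  ab zero    | no _ = orb 0 , orb 1
  ab (suc i) | no _ = proj₂ (ab i) , proj₂ (ab i)

  a : ℕ → Fin n
  a = proj₁ ∘ ab

  b : ℕ → Fin n
  b = proj₂ ∘ ab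

IsSingleCycle : (m : ℕ) → Permutation′ (suc m) → Set
IsSingleCycle m π = ∀ (x : Fin (suc m)) → ∃ λ k → Construction.orb m π k ≡ x

{-# OPTIONS --safe #-}
module Submission where

-- φ is a bijection of ℤ_{n²} (its inverse is multiplication by n² − n + 1), so the
-- indices i with φ(i) distinguished are exactly g n + ((π^g(0) − g) mod n), one in
-- each block {g n, …, g n + n − 1}.  Hence on block g the word b equals π^g(0) before
-- the distinguished index and π^{g+1}(0) from it on.  At an ordinary index
-- a_{i+1} = b_i by construction; at the distinguished index of block g,
-- a_{i+1} = π^g(0) is also the value of b just before it (at the end of block g − 1
-- when the offset is 0).  At the wrap-around, b_{n²−1} = π^n(0) = 0 = a_0 because π
-- is a single n-cycle.

open import Defs
open import Data.Nat using (ℕ; zero; suc; _+_; _*_; _∸_; _%_; _/_; _<_; _≤_; z≤n; s≤s; NonZero)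
open import Data.Nat.Properties
open import Data.Nat.DivMod
open import Data.Nat.Solver using (module +-*-Solver)
open import Data.Fin using (Fin; toℕ; fromℕ<) renaming (zero to fzero)
open import Data.Fin.Properties using (any?; pigeonhole; injective⇒≤; toℕ<n; toℕ-fromℕ<)
open import Data.Fin.Permutation using (Permutation′; _⟨$⟩ʳ_; _⟨$⟩ˡ_; inverseˡ)
open import Data.Product using (_×_; _,_; ∃; proj₁; proj₂)
open import Data.Sum using (inj₁; inj₂)
open import Data.Empty using (⊥-elim)
open import Function using (_∘_)
open import Relation.Nullary using (yes; no)
open import Relation.Binary.PropositionalEquality
  using (_≡_; _≢_; refl; sym; trans; cong; subst; module ≡-Reasoning)

open +-*-Solver using (solve; _:=_; _:+_; _:*_; con)
open ≡-Reasoning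

divMod-unique : ∀ {n a b x y} .{{_ : NonZero n}} → x < n → y < n →
                a * n + x ≡ b * n + y → a ≡ b × x ≡ y
divMod-unique {n} {a} {b} {x} {y} x<n y<n eq = a≡b , x≡y
  where
  x≡y : x ≡ y
  x≡y = begin
    x               ≡⟨ m<n⇒m%n≡m x<n ⟨
    x % n           ≡⟨ [m+kn]%n≡m%n x a n ⟨
    (x + a * n) % n ≡⟨ cong (_% n) (trans (+-comm x (a * n)) (trans eq (+-comm (b * n) y))) ⟩
    (y + b * n) % n ≡⟨ [m+kn]%n≡m%n y b n ⟩
    y % n           ≡⟨ m<n⇒m%n≡m y<n ⟩
    y               ∎

  a≡b : a ≡ b
  a≡b = *-cancelʳ-≡ a b n (+-cancelʳ-≡ x (a * n) (b * n) (trans eq (cong (b * n +_) (sym x≡y))))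

*%-inverse : ∀ {N p q} i .{{_ : NonZero N}} → (p * q) % N ≡ 1 % N →
             (((i * p) % N) * q) % N ≡ i % N
*%-inverse {N} {p} {q} i pq≡1 = begin
  (((i * p) % N) * q) % N          ≡⟨ %-distribˡ-* ((i * p) % N) q N ⟩
  (((i * p) % N % N) * (q % N)) % N ≡⟨ cong (λ z → (z * (q % N)) % N) (m%n%n≡m%n (i * p) N) ⟩
  (((i * p) % N) * (q % N)) % N    ≡⟨ %-distribˡ-* (i * p) q N ⟨
  (i * p * q) % N                  ≡⟨ cong (_% N) (*-assoc i p q) ⟩
  (i * (p * q)) % N                ≡⟨ %-distribˡ-* i (p * q) N ⟩
  ((i % N) * ((p * q) % N)) % N    ≡⟨ cong (λ z → ((i % N) * z) % N) pq≡1 ⟩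
  ((i % N) * (1 % N)) % N          ≡⟨ %-distribˡ-* i 1 N ⟨
  (i * 1) % N                      ≡⟨ cong (_% N) (*-identityʳ i) ⟩
  i % N                            ∎

*%-injective : ∀ {N p q i j} .{{_ : NonZero N}} → (p * q) % N ≡ 1 % N →
               i < N → j < N → (i * p) % N ≡ (j * p) % N → i ≡ j
*%-injective {N} {p} {q} {i} {j} pq≡1 i<N j<N eq = begin
  i                       ≡⟨ m<n⇒m%n≡m i<N ⟨
  i % N                   ≡⟨ *%-inverse i pq≡1 ⟨
  (((i * p) % N) * q) % N ≡⟨ cong (λ z → (z * q) % N) eq ⟩
  (((j * p) % N) * q) % N ≡⟨ *%-inverse j pq≡1 ⟩
  j % N                   ≡⟨ m<n⇒m%n≡m j<N ⟩
  j                       ∎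

module _ (m : ℕ) (π : Permutation′ (suc m)) where
  open Construction m π

  πpow-+ : ∀ k l x → πpow (k + l) x ≡ πpow k (πpow l x)
  πpow-+ zero    l x = refl
  πpow-+ (suc k) l x = cong (π ⟨$⟩ʳ_) (πpow-+ k l x)

  πpow-injective : ∀ k {x y} → πpow k x ≡ πpow k y → x ≡ y
  πpow-injective zero    eq = eq
  πpow-injective (suc k) {x} {y} eq = πpow-injective k (begin
    πpow k x                        ≡⟨ inverseˡ π ⟨
    π ⟨$⟩ˡ (π ⟨$⟩ʳ πpow k x)        ≡⟨ cong (π ⟨$⟩ˡ_) eq ⟩
    π ⟨$⟩ˡ (π ⟨$⟩ʳ πpow k y)        ≡⟨ inverseˡ π ⟩
    πpow k y                        ∎)

  orb-*-period : ∀ {d} → orb d ≡ fzero → ∀ c → orb (c * d) ≡ fzero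
  orb-*-period         _   zero    = refl
  orb-*-period {d} orb-d≡0 (suc c) = begin
    orb (d + c * d)       ≡⟨ πpow-+ d (c * d) fzero ⟩
    πpow d (orb (c * d))  ≡⟨ cong (πpow d) (orb-*-period orb-d≡0 c) ⟩
    orb d                 ≡⟨ orb-d≡0 ⟩
    fzero                 ∎

  orb-%-period : ∀ {d} .{{_ : NonZero d}} → orb d ≡ fzero → ∀ k → orb k ≡ orb (k % d)
  orb-%-period {d} orb-d≡0 k = begin
    orb k                             ≡⟨ cong orb (m≡m%n+[m/n]*n k d) ⟩
    orb (k % d + (k / d) * d)         ≡⟨ πpow-+ (k % d) ((k / d) * d) fzero ⟩
    πpow (k % d) (orb ((k / d) * d))  ≡⟨ cong (πpow (k % d)) (orb-*-period orb-d≡0 (k / d)) ⟩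
    orb (k % d)                       ∎

  orb-returns : ∃ λ d → suc d ≤ n × orb (suc d) ≡ fzero
  orb-returns with pigeonhole (n<1+n n) (orb ∘ toℕ)
  ... | i , j , i<j , orb-i≡orb-j with m≤n⇒∃[o]m+o≡n i<j
  ... | d , i+1+d≡j = d , 1+d≤n , πpow-injective (toℕ i) (begin
    πpow (toℕ i) (orb (suc d)) ≡⟨ πpow-+ (toℕ i) (suc d) fzero ⟨
    orb (toℕ i + suc d)        ≡⟨ cong orb i+[1+d]≡j ⟩
    orb (toℕ j)                ≡⟨ orb-i≡orb-j ⟨
    orb (toℕ i)                ∎)
    where
    i+[1+d]≡j : toℕ i + suc d ≡ toℕ j
    i+[1+d]≡j = trans (+-suc (toℕ i) d) i+1+d≡j

    1+d≤n : suc d ≤ n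
    1+d≤n = ≤-trans (m≤n+m (suc d) (toℕ i)) (subst (_≤ n) (sym i+[1+d]≡j) (≤-pred (toℕ<n j)))

  -- A return time 1 + d ≤ n gives an injection x ↦ (time to reach x) mod (1 + d) from
  -- ℤ_n into ℤ_{1+d}, so 1 + d = n.
  singleCycle⇒orb-n≡0 : IsSingleCycle m π → orb n ≡ fzero
  singleCycle⇒orb-n≡0 single with orb-returns
  ... | d , 1+d≤n , orb-1+d≡0 = subst (λ k → orb k ≡ fzero) 1+d≡n orb-1+d≡0
    where
    time : Fin n → Fin (suc d)
    time x = fromℕ< (m%n<n (proj₁ (single x)) (suc d))

    orb-time : ∀ x → orb (toℕ (time x)) ≡ x
    orb-time x = begin
      orb (toℕ (time x))              ≡⟨ cong orb (toℕ-fromℕ< (m%n<n (proj₁ (single x)) (suc d))) ⟩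
      orb (proj₁ (single x) % suc d)  ≡⟨ orb-%-period orb-1+d≡0 (proj₁ (single x)) ⟨
      orb (proj₁ (single x))          ≡⟨ proj₂ (single x) ⟩
      x                               ∎

    1+d≡n : suc d ≡ n
    1+d≡n = ≤-antisym 1+d≤n (injective⇒≤ {f = time} (λ {x} {y} eq →
      trans (sym (orb-time x)) (trans (cong (orb ∘ toℕ) eq) (orb-time y))))

  -- The distinguished index of block g is g * n + offset g.
  offset : ℕ → ℕ
  offset g = subMod (toℕ (orb g)) g

  offset<n : ∀ g → offset g < n
  offset<n g = m%n<n (toℕ (orb g) + n ∸ g) n

  offset-0 : offset 0 ≡ 0
  offset-0 = n%n≡0 n

  block<N : ∀ {g r} → g < n → r < n → g * n + r < N
  block<N {g} {r} g<n r<n = <-≤-trans (+-monoʳ-< (g * n) r<n)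
    (subst (_≤ N) (+-comm n (g * n)) (*-monoˡ-≤ n g<n))

  block-end-suc : ∀ g → suc (g * n + m) ≡ suc g * n + 0
  block-end-suc g = solve 2 (λ g m → con 1 :+ (g :* (con 1 :+ m) :+ m)
                                   := (con 1 :+ g) :* (con 1 :+ m) :+ con 0) refl g m

  φ-injective : ∀ {i j} → i < N → j < N → φ i ≡ φ j → i ≡ j
  φ-injective = *%-injective {q = m * n + 1} (begin
    (p * (m * n + 1)) % N ≡⟨ cong (_% N) p*q≡1+n*N ⟩
    (1 + n * N) % N       ≡⟨ [m+kn]%n≡m%n 1 n N ⟩
    1 % N                 ∎)
    where
    p*q≡1+n*N : p * (m * n + 1) ≡ 1 + n * N
    p*q≡1+n*N = solve 1 (λ m → (con 2 :+ m) :* (m :* (con 1 :+ m) :+ con 1)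
                              := con 1 :+ (con 1 :+ m) :* ((con 1 :+ m) :* (con 1 :+ m))) refl m

  φ≡distPos⇒distinguished : ∀ {g r} (k : Fin n) → g < n → r < n → φ (g * n + r) ≡ distPos k →
                            toℕ k ≡ g × offset (toℕ k) ≡ r
  φ≡distPos⇒distinguished {g} {r} k g<n r<n eq =
    divMod-unique (offset<n (toℕ k)) r<n
      (sym (φ-injective (block<N g<n r<n) (block<N (toℕ<n k) (offset<n (toℕ k))) eq))

  ab-distinguished : ∀ {g} → g < n → ab (g * n + offset g) ≡ (orb g , orb (suc g))
  ab-distinguished {g} g<n with any? (λ k → φ (g * n + offset g) ≟ distPos k)
  ... | yes (k , eq) = cong (λ j → orb j , orb (suc j))
                            (proj₁ (φ≡distPos⇒distinguished k g<n (offset<n g) eq))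
  ... | no ¬distinguished = ⊥-elim (¬distinguished (fromℕ< g<n ,
          cong (λ j → φ (j * n + offset j)) (sym (toℕ-fromℕ< g<n))))

  ab-ordinary : ∀ {g r i} → g < n → r < n → r ≢ offset g → suc i ≡ g * n + r →
                ab (suc i) ≡ (b i , b i)
  ab-ordinary {g} {r} {i} g<n r<n r≢offset 1+i≡gn+r with any? (λ k → φ (suc i) ≟ distPos k)
  ... | no _ = refl
  ... | yes (k , eq)
    with refl , offset≡r ← φ≡distPos⇒distinguished k g<n r<n
                             (subst (λ j → φ j ≡ distPos k) 1+i≡gn+r eq)
    = ⊥-elim (r≢offset (sym offset≡r))

  b-step : ∀ {g r} → g < n → suc r < n → suc r ≢ offset g → b (g * n + suc r) ≡ b (g * n + r)
  b-step {g} {r} g<n r<n 1+r≢offset = begin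
    b (g * n + suc r)   ≡⟨ cong b (+-suc (g * n) r) ⟩
    b (suc (g * n + r)) ≡⟨ cong proj₂ (ab-ordinary g<n r<n 1+r≢offset (sym (+-suc (g * n) r))) ⟩
    b (g * n + r)       ∎

  b-after : ∀ {g r} → g < n → r < n → offset g ≤ r → b (g * n + r) ≡ orb (suc g)
  b-after {g} g<n r<n offset≤r with m≤n⇒m<n∨m≡n offset≤r
  ... | inj₂ refl = cong proj₂ (ab-distinguished g<n)
  ... | inj₁ offset<r@(s≤s offset≤r′) =
    trans (b-step g<n r<n (>⇒≢ offset<r)) (b-after g<n (<-trans (n<1+n _) r<n) offset≤r′)

  b-block-end : ∀ {g} → g < n → b (g * n + m) ≡ orb (suc g)
  b-block-end {g} g<n = b-after g<n (n<1+n m) (≤-pred (offset<n g))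

  b-before : ∀ {g r} → g < n → r < offset g → b (g * n + r) ≡ orb g
  b-before {zero} {r} _ r<offset = ⊥-elim (n≮0 (subst (r <_) offset-0 r<offset))
  b-before {suc g} {zero} g<n 0<offset = begin
    b (suc g * n + 0)   ≡⟨ cong b (block-end-suc g) ⟨
    b (suc (g * n + m)) ≡⟨ cong proj₂ (ab-ordinary g<n (s≤s z≤n) (<⇒≢ 0<offset) (block-end-suc g)) ⟩
    b (g * n + m)       ≡⟨ b-block-end (<-trans (n<1+n g) g<n) ⟩
    orb (suc g)         ∎
  b-before {g} {suc r} g<n r<offset =
    trans (b-step g<n (<-trans r<offset (offset<n g)) (<⇒≢ r<offset))
          (b-before g<n (<-trans (n<1+n r) r<offset))

  b-just-before : ∀ {g r i} → g < n → r ≤ offset g → suc i ≡ g * n + r → b i ≡ orb g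
  b-just-before {zero}  {zero}  _   _ ()
  b-just-before {suc g} {zero}  {i} g<n _ 1+i≡gn = begin
    b i           ≡⟨ cong b (suc-injective (trans 1+i≡gn (sym (block-end-suc g)))) ⟩
    b (g * n + m) ≡⟨ b-block-end (<-trans (n<1+n g) g<n) ⟩
    orb (suc g)   ∎
  b-just-before {g}     {suc r} {i} g<n r<offset 1+i≡gn+1+r = begin
    b i           ≡⟨ cong b (suc-injective (trans 1+i≡gn+1+r (+-suc (g * n) r))) ⟩
    b (g * n + r) ≡⟨ b-before g<n r<offset ⟩
    orb g         ∎

  b≡a-suc : ∀ {g r i} → g < n → r < n → suc i ≡ g * n + r → b i ≡ a (suc i)
  b≡a-suc {g} {r} {i} g<n r<n 1+i≡gn+r with r ≟ offset g
  ... | no r≢offset = sym (cong proj₁ (ab-ordinary g<n r<n r≢offset 1+i≡gn+r))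
  ... | yes refl = begin
    b i                  ≡⟨ b-just-before g<n ≤-refl 1+i≡gn+r ⟩
    orb g                ≡⟨ cong proj₁ (ab-distinguished g<n) ⟨
    a (g * n + offset g) ≡⟨ cong a 1+i≡gn+r ⟨
    a (suc i)            ∎

  b≡a-suc-inside : ∀ {i} → suc i < N → b i ≡ a (suc i)
  b≡a-suc-inside {i} 1+i<N = b≡a-suc (m<n*o⇒m/o<n 1+i<N) (m%n<n (suc i) n)
    (trans (m≡m%n+[m/n]*n (suc i) n) (+-comm (suc i % n) (suc i / n * n)))

  b≡a-0-at-end : IsSingleCycle m π → ∀ {i} → suc i ≡ N → b i ≡ a 0
  b≡a-0-at-end single {i} 1+i≡N = begin
    b i           ≡⟨ cong b (suc-injective 1+i≡1+[mn+m]) ⟩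
    b (m * n + m) ≡⟨ b-block-end (n<1+n m) ⟩
    orb n         ≡⟨ singleCycle⇒orb-n≡0 single ⟩
    orb 0         ≡⟨ cong proj₁ (ab-distinguished (s≤s z≤n)) ⟨
    a (offset 0)  ≡⟨ cong a offset-0 ⟩
    a 0           ∎
    where
    1+i≡1+[mn+m] : suc i ≡ suc (m * n + m)
    1+i≡1+[mn+m] = trans 1+i≡N (sym (trans (block-end-suc m) (+-identityʳ N)))

lemma5 : (m : ℕ) (π : Permutation′ (suc m)) → IsSingleCycle m π →
    ∀ (i : ℕ) → i < suc m * suc m →
      Construction.b m π i ≡ Construction.a m π ((suc i) % (suc m * suc m))
lemma5 m π single i i<N with m≤n⇒m<n∨m≡n i<N
... | inj₁ 1+i<N = begin
  b i             ≡⟨ b≡a-suc-inside m π 1+i<N ⟩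
  a (suc i)       ≡⟨ cong a (m<n⇒m%n≡m 1+i<N) ⟨
  a (suc i % N)   ∎
  where open Construction m π
... | inj₂ 1+i≡N = begin
  b i             ≡⟨ b≡a-0-at-end m π single 1+i≡N ⟩
  a 0             ≡⟨ cong a (trans (cong (_% N) 1+i≡N) (n%n≡0 N)) ⟨
  a (suc i % N)   ∎
  where open Construction m π
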